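{- (i) For $n\ge4$, $R_n^{(1,0,1,1)}(x)$ has degree $n-3$ and leading coefficient $4(n-3)!$. (ii) For $n\ge5$, $R_n^{(1,1,1,1)}(x)$ has degree $n-4$ and leading coefficient $16(n-4)!$.
   Context: For $\sigma=\sigma_1\cdots\sigma_n\in S_n$ and $a,b,c,d\in\mathbb{N}$, $\sigma_i$ matches $MMP(a,b,c,d)$ if there are at least $a$ indices $j>i$ with $\sigma_j>\sigma_i$, at least $b$ indices $j<i$ with $\sigma_j>\sigma_i$, at least $c$ indices $j<i$ with $\sigma_j<\sigma_i$, and at least $d$ indices $j>i$ with $\sigma_j<\sigma_i$. $mmp^{(a,b,c,d)}(\sigma)$ is the number of such $i$, and $R_n^{(a,b,c,d)}(x)=\sum_{\sigma\in S_n}x^{mmp^{(a,b,c,d)}(\sigma)}$. -}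

module Defs where

open import Data.Nat as ℕ using (ℕ; zero; suc; _≤_; _≤?_)
open import Data.Fin as Fin using (Fin)
open import Data.Fin.Properties using (_<?_)
open import Data.List using (List; []; _∷_; [_]; map; concatMap; filter; length)
open import Data.List.Relation.Unary.Unique.Propositional using (Unique)
open import Data.List.Relation.Unary.Unique.DecPropositional using (unique?)
open import Data.Fin.Properties using (_≟_)
open import Data.Vec as Vec using (Vec; []; _∷_; lookup; toList)
open import Data.Product using (_×_)
open import Relation.Nullary.Decidable using (_×-dec_)
import Data.List.Base
open import Relation.Binary.PropositionalEquality using (_≡_; _≢_)

allWords : (n m : ℕ) → List (Vec (Fin n) m)
allWords n zero    = [ [] ]
allWords n (suc m) = concatMap (λ i → map (i ∷_) (allWords n m)) (Data.List.Base.allFin n)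

-- A permutation σ = σ₁⋯σₙ ∈ Sₙ is a word of length n over [n] = Fin n with
-- pairwise distinct letters (one-line notation, 0-indexed values and positions).
IsPerm : {n : ℕ} → Vec (Fin n) n → Set
IsPerm σ = Unique (toList σ)

Sym : (n : ℕ) → List (Vec (Fin n) n)
Sym n = filter (λ σ → unique? _≟_ (toList σ)) (allWords n n)

aboveRight aboveLeft belowLeft belowRight : {n : ℕ} → Vec (Fin n) n → Fin n → ℕ
aboveRight {n} σ i = length (filter (λ j → (i <? j) ×-dec (lookup σ i <? lookup σ j)) (Data.List.Base.allFin n))
aboveLeft  {n} σ i = length (filter (λ j → (j <? i) ×-dec (lookup σ i <? lookup σ j)) (Data.List.Base.allFin n))
belowLeft  {n} σ i = length (filter (λ j → (j <? i) ×-dec (lookup σ j <? lookup σ i)) (Data.List.Base.allFin n))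
belowRight {n} σ i = length (filter (λ j → (i <? j) ×-dec (lookup σ j <? lookup σ i)) (Data.List.Base.allFin n))

MatchesMMP : (a b c d : ℕ) → {n : ℕ} → Vec (Fin n) n → Fin n → Set
MatchesMMP a b c d σ i =
  (a ≤ aboveRight σ i) × (b ≤ aboveLeft σ i) × (c ≤ belowLeft σ i) × (d ≤ belowRight σ i)

mmp : (a b c d : ℕ) → {n : ℕ} → Vec (Fin n) n → ℕ
mmp a b c d {n} σ = length (filter (λ i →
    (a ≤? aboveRight σ i) ×-dec (b ≤? aboveLeft σ i) ×-dec
    (c ≤? belowLeft σ i) ×-dec (d ≤? belowRight σ i))
  (Data.List.Base.allFin n))

-- Coefficient of x^k in R_n^{(a,b,c,d)}(x) = Σ_{σ ∈ Sₙ} x^{mmp(σ)}.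
Rcoeff : (a b c d n k : ℕ) → ℕ
Rcoeff a b c d n k = length (filter (λ σ → mmp a b c d σ ℕ.≟ k) (Sym n))

HasDegreeLeading : (a b c d n D L : ℕ) → Set
HasDegreeLeading a b c d n D L =
  (Rcoeff a b c d n D ≡ L) × (L ≢ 0) × (∀ k → D ℕ.< k → Rcoeff a b c d n k ≡ 0)

-- An outer position (the first one, resp. the first two, and the last two) can never match, so
-- mmp ≤ m with m = n − 3 (resp. n − 4).  If mmp = m, every inner position has smaller entries on both
-- sides and a larger one to its right (resp. larger ones on both sides), which pins the inner values
-- to 2, …, m+1.  Such a permutation is an arbitrary permutation of the inner block (m! choices) together
-- with an arrangement of the outer values at the outer positions, and whether the inner positions match
-- only depends on which outer values are low (0 or 1): the first entry must be low and the last two one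
-- low and one high (resp. each of the two outer pairs must be one low and one high).  A finite check
-- finds 4 (resp. 16) such arrangements.

module Submission where

open import Defs
open import Data.Nat using (ℕ; zero; suc; _+_; _*_; _∸_; _≤_; _<_; z≤n; s≤s; _!; ≢-nonZero⁻¹)
import Data.Nat as ℕ
open import Data.Nat.Properties
open import Data.Fin as Fin using (Fin; toℕ; punchIn; punchOut; _↑ˡ_; _↑ʳ_)
open import Data.Fin.Patterns using (0F; 1F; 2F; 3F)
import Data.Fin.Properties as FinP
open import Data.List as List using (List; []; _∷_; map; concatMap; filter; length; _++_; allFin)
open import Data.List.Membership.Propositional using (_∈_)
open import Data.List.Membership.Propositional.Properties using (∈-filter⁺; ∈-filter⁻; ∈-allFin)
open import Data.List.Relation.Unary.All using (All; []; _∷_)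
open import Data.List.Relation.Unary.AllPairs using ([]; _∷_)
open import Data.List.Relation.Unary.Any using (here)
open import Data.List.Relation.Unary.Unique.Propositional using (Unique)
open import Data.List.Relation.Unary.Unique.DecPropositional using (unique?)
open import Data.Vec as Vec using (Vec; []; _∷_; lookup; tabulate; toList)
import Data.Vec.Properties as VecP
import Data.Product.Properties as ProdP
open import Data.Product using (_×_; _,_; proj₁; proj₂; ∃; ∃-syntax)
open import Data.Sum using (_⊎_; inj₁; inj₂; [_,_]′)
import Data.Sum.Properties as Sum
open import Data.Empty using (⊥-elim)
open import Relation.Nullary using (Dec; yes; no; ¬_)
open import Relation.Nullary.Decidable using (_×-dec_; _⊎-dec_; ¬?; map′)
open import Relation.Unary using (Pred; Decidable)
open import Relation.Binary using (DecidableEquality)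
open import Relation.Binary.PropositionalEquality
open import Function using (_∘_; id)
open import Function.Definitions using (Injective)
open import Level using (0ℓ)
open import Algebra.Properties.CommutativeMonoid.Sum +-0-commutativeMonoid using (sum; sum-cong-≗)
open import Algebra.Properties.CommutativeSemigroup +-commutativeSemigroup using (interchange; x∙yz≈y∙xz)

private variable
  A B C P Q : Set
  k n : ℕ

⟦_⟧ : Dec P → ℕ
⟦ yes _ ⟧ = 1
⟦ no _ ⟧ = 0

⟦⟧-cong : (p : Dec P) (q : Dec Q) → (P → Q) → (Q → P) → ⟦ p ⟧ ≡ ⟦ q ⟧
⟦⟧-cong (yes _) (yes _) _ _ = refl
⟦⟧-cong (yes p) (no ¬q) f _ = ⊥-elim (¬q (f p))
⟦⟧-cong (no ¬p) (yes q) _ g = ⊥-elim (¬p (g q))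
⟦⟧-cong (no _)  (no _)  _ _ = refl

⟦⟧-yes : (p : Dec P) → P → ⟦ p ⟧ ≡ 1
⟦⟧-yes (yes _) _ = refl
⟦⟧-yes (no ¬p) p = ⊥-elim (¬p p)

⟦⟧-no : (p : Dec P) → ¬ P → ⟦ p ⟧ ≡ 0
⟦⟧-no (yes p) ¬p = ⊥-elim (¬p p)
⟦⟧-no (no _)  _  = refl

⟦⟧≤1 : (p : Dec P) → ⟦ p ⟧ ≤ 1
⟦⟧≤1 (yes _) = s≤s z≤n
⟦⟧≤1 (no _)  = z≤n

⟦⟧≡1⇒ : (p : Dec P) → ⟦ p ⟧ ≡ 1 → P
⟦⟧≡1⇒ (yes p) _ = p

⟦×-dec⟧ : (p : Dec P) (q : Dec Q) → ⟦ p ×-dec q ⟧ ≡ ⟦ p ⟧ * ⟦ q ⟧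
⟦×-dec⟧ (yes _) (yes _) = refl
⟦×-dec⟧ (yes _) (no _)  = refl
⟦×-dec⟧ (no _)  (yes _) = refl
⟦×-dec⟧ (no _)  (no _)  = refl

sumL : List A → (A → ℕ) → ℕ
sumL []       f = 0
sumL (x ∷ xs) f = f x + sumL xs f

sumL-cong : (xs : List A) {f g : A → ℕ} → (∀ x → f x ≡ g x) → sumL xs f ≡ sumL xs g
sumL-cong []       e = refl
sumL-cong (x ∷ xs) e = cong₂ _+_ (e x) (sumL-cong xs e)

sumL-zero : (xs : List A) {f : A → ℕ} → (∀ x → f x ≡ 0) → sumL xs f ≡ 0
sumL-zero []       e = refl
sumL-zero (x ∷ xs) e rewrite e x = sumL-zero xs e

sumL-+ : (xs : List A) (f g : A → ℕ) → sumL xs (λ x → f x + g x) ≡ sumL xs f + sumL xs g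
sumL-+ []       f g = refl
sumL-+ (x ∷ xs) f g rewrite sumL-+ xs f g = interchange (f x) (g x) (sumL xs f) (sumL xs g)

sumL-*ˡ : (xs : List A) (c : ℕ) (f : A → ℕ) → sumL xs (λ x → c * f x) ≡ c * sumL xs f
sumL-*ˡ []       c f = sym (*-zeroʳ c)
sumL-*ˡ (x ∷ xs) c f rewrite sumL-*ˡ xs c f = sym (*-distribˡ-+ c (f x) (sumL xs f))

sumL-*ʳ : (xs : List A) (c : ℕ) (f : A → ℕ) → sumL xs (λ x → f x * c) ≡ sumL xs f * c
sumL-*ʳ []       c f = refl
sumL-*ʳ (x ∷ xs) c f rewrite sumL-*ʳ xs c f = sym (*-distribʳ-+ c (f x) (sumL xs f))

sumL-swap : (xs : List A) (ys : List B) (h : A → B → ℕ) →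
            sumL xs (λ x → sumL ys (h x)) ≡ sumL ys (λ y → sumL xs (λ x → h x y))
sumL-swap []       ys h = sym (sumL-zero ys (λ _ → refl))
sumL-swap (x ∷ xs) ys h rewrite sumL-swap xs ys h = sym (sumL-+ ys (h x) (λ y → sumL xs (λ x → h x y)))

sumL-++ : (xs ys : List A) (f : A → ℕ) → sumL (xs ++ ys) f ≡ sumL xs f + sumL ys f
sumL-++ []       ys f = refl
sumL-++ (x ∷ xs) ys f rewrite sumL-++ xs ys f = sym (+-assoc (f x) _ _)

sumL-map : (g : A → B) (xs : List A) (f : B → ℕ) → sumL (map g xs) f ≡ sumL xs (f ∘ g)
sumL-map g []       f = refl
sumL-map g (x ∷ xs) f = cong (f (g x) +_) (sumL-map g xs f)

sumL-concatMap : (F : A → List B) (xs : List A) (f : B → ℕ) →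
                 sumL (concatMap F xs) f ≡ sumL xs (λ x → sumL (F x) f)
sumL-concatMap F []       f = refl
sumL-concatMap F (x ∷ xs) f =
  trans (sumL-++ (F x) (concatMap F xs) f) (cong (sumL (F x) f +_) (sumL-concatMap F xs f))

sumL-filter : {R : Pred A 0ℓ} (R? : Decidable R) (xs : List A) (f : A → ℕ) →
              sumL (filter R? xs) f ≡ sumL xs (λ x → ⟦ R? x ⟧ * f x)
sumL-filter R? []       f = refl
sumL-filter R? (x ∷ xs) f with R? x
... | yes _ = cong₂ _+_ (sym (+-identityʳ (f x))) (sumL-filter R? xs f)
... | no  _ = sumL-filter R? xs f

length≡sumL : (xs : List A) → length xs ≡ sumL xs (λ _ → 1)
length≡sumL []       = refl
length≡sumL (x ∷ xs) = cong suc (length≡sumL xs)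

length-filter≡sumL : {R : Pred A 0ℓ} (R? : Decidable R) (xs : List A) →
                     length (filter R? xs) ≡ sumL xs (λ x → ⟦ R? x ⟧)
length-filter≡sumL R? xs = trans (length≡sumL (filter R? xs))
  (trans (sumL-filter R? xs (λ _ → 1)) (sumL-cong xs (λ x → *-identityʳ ⟦ R? x ⟧)))

-- Each element occurs exactly once.  Quantifying over the decision procedure spares passing one around.
Enumerates : List A → Set
Enumerates {A} xs = ∀ (x₀ : A) (_≟_ : DecidableEquality A) → sumL xs (λ x → ⟦ x ≟ x₀ ⟧) ≡ 1

module _ {X Y : Set} (xs : List X) (ys : List Y) (_≟X_ : DecidableEquality X) (_≟Y_ : DecidableEquality Y)
         (enum-xs : Enumerates xs) (enum-ys : Enumerates ys)
         {P : Pred X 0ℓ} {Q : Pred Y 0ℓ} (P? : Decidable P) (Q? : Decidable Q)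
         (f : X → Y) (g : Y → X)
         (f-resp : ∀ x → P x → Q (f x)) (g-resp : ∀ y → Q y → P (g y))
         (g∘f : ∀ x → P x → g (f x) ≡ x) (f∘g : ∀ y → Q y → f (g y) ≡ y) where

  -- Double counting of the pairs (x , f x) with P x.
  count-transfer : sumL xs (λ x → ⟦ P? x ⟧) ≡ sumL ys (λ y → ⟦ Q? y ⟧)
  count-transfer = begin
    sumL xs (λ x → ⟦ P? x ⟧)          ≡⟨ sumL-cong xs (λ x → sym (row x)) ⟩
    sumL xs (λ x → sumL ys (h x))     ≡⟨ sumL-swap xs ys h ⟩
    sumL ys (λ y → sumL xs (λ x → h x y)) ≡⟨ sumL-cong ys column ⟩
    sumL ys (λ y → ⟦ Q? y ⟧)          ∎
    where
    open ≡-Reasoning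
    h : X → Y → ℕ
    h x y = ⟦ P? x ⟧ * ⟦ f x ≟Y y ⟧

    row : ∀ x → sumL ys (h x) ≡ ⟦ P? x ⟧
    row x = begin
      sumL ys (h x)                            ≡⟨ sumL-*ˡ ys ⟦ P? x ⟧ (λ y → ⟦ f x ≟Y y ⟧) ⟩
      ⟦ P? x ⟧ * sumL ys (λ y → ⟦ f x ≟Y y ⟧)  ≡⟨ cong (⟦ P? x ⟧ *_) (sumL-cong ys λ _ → ⟦⟧-cong _ _ sym sym) ⟩
      ⟦ P? x ⟧ * sumL ys (λ y → ⟦ y ≟Y f x ⟧)  ≡⟨ cong (⟦ P? x ⟧ *_) (enum-ys (f x) _≟Y_) ⟩
      ⟦ P? x ⟧ * 1                             ≡⟨ *-identityʳ _ ⟩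
      ⟦ P? x ⟧                                 ∎

    column : ∀ y → sumL xs (λ x → h x y) ≡ ⟦ Q? y ⟧
    column y with Q? y
    ... | yes q = trans (sumL-cong xs delta) (enum-xs (g y) _≟X_)
      where
      delta : ∀ x → h x y ≡ ⟦ x ≟X g y ⟧
      delta x with P? x | f x ≟Y y | x ≟X g y
      ... | yes p | yes e  | yes _  = refl
      ... | yes p | yes e  | no ne  = ⊥-elim (ne (trans (sym (g∘f x p)) (cong g e)))
      ... | yes p | no ne  | yes e  = ⊥-elim (ne (trans (cong f e) (f∘g y q)))
      ... | yes p | no _   | no _   = refl
      ... | no ¬p | _      | yes e  = ⊥-elim (¬p (subst P (sym e) (g-resp y q)))
      ... | no _  | _      | no _   = refl
    ... | no ¬q = sumL-zero xs vanish
      where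
      vanish : ∀ x → h x y ≡ 0
      vanish x with P? x | f x ≟Y y
      ... | yes p | yes e = ⊥-elim (¬q (subst Q e (f-resp x p)))
      ... | yes p | no _  = refl
      ... | no _  | _     = refl

sumL-allFin : (f : Fin n → ℕ) → sumL (allFin n) f ≡ sum f
sumL-allFin {n} f = go n id
  where
  go : ∀ n (t : Fin n → Fin _) → sumL (List.tabulate t) f ≡ sum (f ∘ t)
  go zero    t = refl
  go (suc n) t = cong (f (t Fin.zero) +_) (go n (t ∘ Fin.suc))

sum-const : (c : ℕ) → sum {n} (λ _ → c) ≡ n * c
sum-const {zero}  c = refl
sum-const {suc n} c = cong (c +_) (sum-const {n} c)

sum-zero : {f : Fin n → ℕ} → (∀ i → f i ≡ 0) → sum f ≡ 0
sum-zero {n} {f} e = trans (sum-cong-≗ e) (trans (sum-const {n} 0) (*-zeroʳ n))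

sum-≤ : {f : Fin n → ℕ} → (∀ i → f i ≤ 1) → sum f ≤ n
sum-≤ {zero}  le = z≤n
sum-≤ {suc n} le = +-mono-≤ (le Fin.zero) (sum-≤ {n} (le ∘ Fin.suc))

sum≡n⇒ : {f : Fin n → ℕ} → (∀ i → f i ≤ 1) → sum f ≡ n → ∀ i → f i ≡ 1
sum≡n⇒ {suc n} {f} le eq i with f Fin.zero in f0≡ | le Fin.zero
sum≡n⇒ {suc n} {f} le eq Fin.zero    | _ | s≤s z≤n = f0≡
sum≡n⇒ {suc n} {f} le eq (Fin.suc i) | _ | s≤s z≤n = sum≡n⇒ {n} (le ∘ Fin.suc) (suc-injective eq) i
sum≡n⇒ {suc n} {f} le eq i           | _ | z≤n     =
  ⊥-elim (<-irrefl eq (s≤s (sum-≤ {n} (le ∘ Fin.suc))))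

sum-↑ : (f : Fin (k + n) → ℕ) → sum f ≡ sum {k} (f ∘ (_↑ˡ n)) + sum {n} (f ∘ (k ↑ʳ_))
sum-↑ {zero}  f = refl
sum-↑ {suc k} {n} f =
  trans (cong (f Fin.zero +_) (sum-↑ {k} {n} (f ∘ Fin.suc))) (sym (+-assoc (f Fin.zero) _ _))

sum-cast : .(eq : k ≡ n) (f : Fin n → ℕ) → sum f ≡ sum (f ∘ Fin.cast eq)
sum-cast {zero}  {zero}  eq f = refl
sum-cast {suc k} {suc n} eq f = cong (f Fin.zero +_) (sum-cast {k} {n} (cong ℕ.pred eq) (f ∘ Fin.suc))

count≡sum : {R : Pred (Fin n) 0ℓ} (R? : Decidable R) →
            length (filter R? (allFin n)) ≡ sum (λ i → ⟦ R? i ⟧)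
count≡sum R? = trans (length-filter≡sumL R? (allFin _)) (sumL-allFin (λ i → ⟦ R? i ⟧))

1≤count⇒∃ : {R : Pred A 0ℓ} (R? : Decidable R) (xs : List A) → 1 ≤ length (filter R? xs) → ∃ R
1≤count⇒∃ R? xs le with filter R? xs in eq
... | y ∷ _ = y , proj₂ (∈-filter⁻ R? {xs = xs} (subst (y ∈_) (sym eq) (here refl)))

∃⇒1≤count : {R : Pred (Fin n) 0ℓ} (R? : Decidable R) → ∃ R → 1 ≤ length (filter R? (allFin n))
∃⇒1≤count {n} R? (i , r) with filter R? (allFin n) | ∈-filter⁺ R? (∈-allFin i) r
... | _ ∷ _ | _ = s≤s z≤n

enumerates-allFin : Enumerates (allFin n)
enumerates-allFin x₀ _≟_ = trans (sumL-allFin (λ x → ⟦ x ≟ x₀ ⟧))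
  (trans (sum-cong-≗ (λ i → ⟦⟧-cong (i ≟ x₀) (i FinP.≟ x₀) id id)) (sum-δ x₀))
  where
  sum-δ : ∀ {n} (x₀ : Fin n) → sum (λ x → ⟦ x FinP.≟ x₀ ⟧) ≡ 1
  sum-δ {suc n} Fin.zero    = cong suc (sum-zero {n} {f = λ x → ⟦ Fin.suc x FinP.≟ Fin.zero ⟧} (λ _ → refl))
  sum-δ {suc n} (Fin.suc y) = trans (sum-cong-≗ (λ i → ⟦⟧-cong (Fin.suc i FinP.≟ Fin.suc y) (i FinP.≟ y)
                                                        FinP.suc-injective (cong Fin.suc)))
                                    (sum-δ y)

enumerates-product : (as : List A) (bs : List B) → DecidableEquality A → DecidableEquality B →
  Enumerates as → Enumerates bs → (c : A → B → C) →
  (∀ {a b a′ b′} → c a b ≡ c a′ b′ → a ≡ a′ × b ≡ b′) → (∀ z → ∃[ a ] ∃[ b ] z ≡ c a b) →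
  Enumerates (concatMap (λ a → map (c a) bs) as)
enumerates-product as bs _≟A_ _≟B_ enum-as enum-bs c c-injective c-surjective z₀ _≟_
  with c-surjective z₀
... | a₀ , b₀ , refl = begin
  sumL (concatMap (λ a → map (c a) bs) as) (λ z → ⟦ z ≟ c a₀ b₀ ⟧)
    ≡⟨ sumL-concatMap _ as _ ⟩
  sumL as (λ a → sumL (map (c a) bs) (λ z → ⟦ z ≟ c a₀ b₀ ⟧))
    ≡⟨ sumL-cong as (λ a → trans (sumL-map (c a) bs _) (sumL-cong bs (λ b → trans
         (⟦⟧-cong (c a b ≟ c a₀ b₀) ((a ≟A a₀) ×-dec (b ≟B b₀)) c-injective (λ { (refl , refl) → refl }))
         (⟦×-dec⟧ (a ≟A a₀) (b ≟B b₀))))) ⟩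
  sumL as (λ a → sumL bs (λ b → ⟦ a ≟A a₀ ⟧ * ⟦ b ≟B b₀ ⟧))
    ≡⟨ sumL-cong as (λ a → trans (sumL-*ˡ bs ⟦ a ≟A a₀ ⟧ _)
         (trans (cong (⟦ a ≟A a₀ ⟧ *_) (enum-bs b₀ _≟B_)) (*-identityʳ _))) ⟩
  sumL as (λ a → ⟦ a ≟A a₀ ⟧)
    ≡⟨ enum-as a₀ _≟A_ ⟩
  1 ∎
  where open ≡-Reasoning

enumerates-allWords : ∀ n k → Enumerates (allWords n k)
enumerates-allWords n zero [] _≟_ = trans (+-identityʳ _) (⟦⟧-yes ([] ≟ []) refl)
enumerates-allWords n (suc k) =
  enumerates-product (allFin n) (allWords n k) FinP._≟_ (VecP.≡-dec FinP._≟_)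
    enumerates-allFin (enumerates-allWords n k) _∷_
    (λ e → VecP.∷-injectiveˡ e , VecP.∷-injectiveʳ e) (λ { (x ∷ xs) → x , xs , refl })

pairs : List A → List B → List (A × B)
pairs as bs = concatMap (λ a → map (a ,_) bs) as

enumerates-pairs : (as : List A) (bs : List B) → DecidableEquality A → DecidableEquality B →
                   Enumerates as → Enumerates bs → Enumerates (pairs as bs)
enumerates-pairs as bs _≟A_ _≟B_ enum-as enum-bs =
  enumerates-product as bs _≟A_ _≟B_ enum-as enum-bs _,_
    (λ { refl → refl , refl }) (λ { (a , b) → a , b , refl })

sumL-pairs : (as : List A) (bs : List B) (f : A × B → ℕ) →
             sumL (pairs as bs) f ≡ sumL as (λ a → sumL bs (λ b → f (a , b)))
sumL-pairs as bs f = trans (sumL-concatMap _ as f) (sumL-cong as (λ a → sumL-map (a ,_) bs f))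

sumL-pairs-⟦×-dec⟧ : (as : List A) (bs : List B) {R : Pred A 0ℓ} {S : Pred B 0ℓ}
                     (R? : Decidable R) (S? : Decidable S) →
  sumL (pairs as bs) (λ y → ⟦ R? (proj₁ y) ×-dec S? (proj₂ y) ⟧)
    ≡ sumL as (λ a → ⟦ R? a ⟧) * sumL bs (λ b → ⟦ S? b ⟧)
sumL-pairs-⟦×-dec⟧ as bs R? S? = begin
  sumL (pairs as bs) (λ y → ⟦ R? (proj₁ y) ×-dec S? (proj₂ y) ⟧)
    ≡⟨ sumL-pairs as bs _ ⟩
  sumL as (λ a → sumL bs (λ b → ⟦ R? a ×-dec S? b ⟧))
    ≡⟨ sumL-cong as (λ a → trans (sumL-cong bs (λ b → ⟦×-dec⟧ (R? a) (S? b)))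
                                 (sumL-*ˡ bs ⟦ R? a ⟧ (λ b → ⟦ S? b ⟧))) ⟩
  sumL as (λ a → ⟦ R? a ⟧ * sumL bs (λ b → ⟦ S? b ⟧))
    ≡⟨ sumL-*ʳ as (sumL bs (λ b → ⟦ S? b ⟧)) (λ a → ⟦ R? a ⟧) ⟩
  sumL as (λ a → ⟦ R? a ⟧) * sumL bs (λ b → ⟦ S? b ⟧) ∎
  where open ≡-Reasoning

≡-by-lookup : (xs ys : Vec A k) → (∀ i → lookup xs i ≡ lookup ys i) → xs ≡ ys
≡-by-lookup xs ys h =
  trans (sym (VecP.tabulate∘lookup xs)) (trans (VecP.tabulate-cong h) (VecP.tabulate∘lookup ys))

IsInjective : Vec A k → Set
IsInjective σ = Injective _≡_ _≡_ (lookup σ)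

All-toList⇒lookup : {R : A → Set} (τ : Vec A k) → All R (toList τ) → ∀ i → R (lookup τ i)
All-toList⇒lookup (y ∷ τ) (r ∷ _)  Fin.zero    = r
All-toList⇒lookup (y ∷ τ) (_ ∷ rs) (Fin.suc i) = All-toList⇒lookup τ rs i

lookup⇒All-toList : {R : A → Set} (τ : Vec A k) → (∀ i → R (lookup τ i)) → All R (toList τ)
lookup⇒All-toList []      r = []
lookup⇒All-toList (y ∷ τ) r = r Fin.zero ∷ lookup⇒All-toList τ (r ∘ Fin.suc)

unique⇒injective : (σ : Vec A k) → Unique (toList σ) → IsInjective σ
unique⇒injective (x ∷ σ) (x∉σ ∷ u) {Fin.zero}  {Fin.zero}  e = refl
unique⇒injective (x ∷ σ) (x∉σ ∷ u) {Fin.zero}  {Fin.suc j} e = ⊥-elim (All-toList⇒lookup σ x∉σ j e)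
unique⇒injective (x ∷ σ) (x∉σ ∷ u) {Fin.suc i} {Fin.zero}  e = ⊥-elim (All-toList⇒lookup σ x∉σ i (sym e))
unique⇒injective (x ∷ σ) (x∉σ ∷ u) {Fin.suc i} {Fin.suc j} e = cong Fin.suc (unique⇒injective σ u e)

injective⇒unique : (σ : Vec A k) → IsInjective σ → Unique (toList σ)
injective⇒unique []      inj = []
injective⇒unique (x ∷ σ) inj =
  lookup⇒All-toList σ (λ i e → FinP.0≢1+n (inj e)) ∷ injective⇒unique σ (FinP.suc-injective ∘ inj)

injective? : (σ : Vec (Fin n) k) → Dec (IsInjective σ)
injective? σ = map′ (unique⇒injective σ) (injective⇒unique σ) (unique? FinP._≟_ (toList σ))

injective⇒surjective : (f : Fin n → Fin n) → Injective _≡_ _≡_ f → ∀ v → ∃[ i ] f i ≡ v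
injective⇒surjective {suc n} f inj v with FinP.any? (λ i → f i FinP.≟ v)
... | yes hit = hit
... | no miss with FinP.pigeonhole (n<1+n n) (λ i → punchOut (λ e → miss (i , sym e)))
... | i , j , i<j , e =
  ⊥-elim (FinP.<⇒≢ i<j (inj (FinP.punchOut-injective (λ e → miss (i , sym e)) (λ e → miss (j , sym e)) e)))

-- punchOut made total: the deleted point itself goes to zero.
deleteAt : Fin (suc (suc n)) → Fin (suc (suc n)) → Fin (suc n)
deleteAt v j with v FinP.≟ j
... | yes _   = Fin.zero
... | no v≢j = punchOut v≢j

deleteAt-punchIn : (v : Fin (suc (suc n))) (j : Fin (suc n)) → deleteAt v (punchIn v j) ≡ j
deleteAt-punchIn v j with v FinP.≟ punchIn v j
... | yes e   = ⊥-elim (FinP.punchInᵢ≢i v j (sym e))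
... | no v≢j = trans (FinP.punchOut-cong v refl) (FinP.punchOut-punchIn v)

punchIn-deleteAt : (v j : Fin (suc (suc n))) → v ≢ j → punchIn v (deleteAt v j) ≡ j
punchIn-deleteAt v j v≢j with v FinP.≟ j
... | yes e   = ⊥-elim (v≢j e)
... | no v≢j′ = FinP.punchIn-punchOut v≢j′

count-injective : ∀ n → sumL (allWords n n) (λ σ → ⟦ injective? σ ⟧) ≡ n !
count-injective zero          = refl
count-injective (suc zero)    = refl
count-injective (suc (suc k)) = begin
  sumL (allWords N N) (λ σ → ⟦ injective? σ ⟧)
    ≡⟨ count-transfer (allWords N N) (pairs (allFin N) (allWords (suc k) (suc k)))
         (VecP.≡-dec FinP._≟_) (ProdP.≡-dec FinP._≟_ (VecP.≡-dec FinP._≟_))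
         (enumerates-allWords N N)
         (enumerates-pairs (allFin N) (allWords (suc k) (suc k)) FinP._≟_ (VecP.≡-dec FinP._≟_)
            enumerates-allFin (enumerates-allWords (suc k) (suc k)))
         injective? (injective? ∘ proj₂) delete insert
         delete-injective insert-injective insert∘delete (λ _ _ → delete∘insert _) ⟩
  sumL (pairs (allFin N) (allWords (suc k) (suc k))) (λ y → ⟦ injective? (proj₂ y) ⟧)
    ≡⟨ sumL-pairs (allFin N) (allWords (suc k) (suc k)) _ ⟩
  sumL (allFin N) (λ _ → sumL (allWords (suc k) (suc k)) (λ τ → ⟦ injective? τ ⟧))
    ≡⟨ trans (sumL-allFin {N} (λ _ → count-smaller)) (sum-const {N} count-smaller) ⟩
  N * sumL (allWords (suc k) (suc k)) (λ τ → ⟦ injective? τ ⟧)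
    ≡⟨ cong (N *_) (count-injective (suc k)) ⟩
  N * suc k ! ∎
  where
  open ≡-Reasoning
  N : ℕ
  N = suc (suc k)

  count-smaller : ℕ
  count-smaller = sumL (allWords (suc k) (suc k)) (λ τ → ⟦ injective? τ ⟧)

  delete : Vec (Fin N) N → Fin N × Vec (Fin (suc k)) (suc k)
  delete (v ∷ τ) = v , Vec.map (deleteAt v) τ

  insert : Fin N × Vec (Fin (suc k)) (suc k) → Vec (Fin N) N
  insert (v , τ) = v ∷ Vec.map (punchIn v) τ

  head≢ : (σ : Vec (Fin N) N) → IsInjective σ → ∀ i → lookup σ Fin.zero ≢ lookup σ (Fin.suc i)
  head≢ σ inj i e = FinP.0≢1+n (inj e)

  delete-injective : ∀ σ → IsInjective σ → IsInjective (proj₂ (delete σ))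
  delete-injective (v ∷ τ) inj {i} {j} e = FinP.suc-injective (inj (begin
    lookup τ i                             ≡⟨ punchIn-deleteAt v _ (head≢ (v ∷ τ) inj i) ⟨
    punchIn v (deleteAt v (lookup τ i))    ≡⟨ cong (punchIn v) (trans (sym (VecP.lookup-map i (deleteAt v) τ))
                                                                 (trans e (VecP.lookup-map j (deleteAt v) τ))) ⟩
    punchIn v (deleteAt v (lookup τ j))    ≡⟨ punchIn-deleteAt v _ (head≢ (v ∷ τ) inj j) ⟩
    lookup τ j                             ∎))

  insert-injective : ∀ y → IsInjective (proj₂ y) → IsInjective (insert y)
  insert-injective (v , τ) inj {Fin.zero}  {Fin.zero}  e = refl
  insert-injective (v , τ) inj {Fin.zero}  {Fin.suc j} e =
    ⊥-elim (FinP.punchInᵢ≢i v (lookup τ j) (sym (trans e (VecP.lookup-map j (punchIn v) τ))))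
  insert-injective (v , τ) inj {Fin.suc i} {Fin.zero}  e =
    ⊥-elim (FinP.punchInᵢ≢i v (lookup τ i) (trans (sym (VecP.lookup-map i (punchIn v) τ)) e))
  insert-injective (v , τ) inj {Fin.suc i} {Fin.suc j} e = cong Fin.suc (inj (FinP.punchIn-injective v _ _
    (trans (sym (VecP.lookup-map i (punchIn v) τ)) (trans e (VecP.lookup-map j (punchIn v) τ)))))

  insert∘delete : ∀ σ → IsInjective σ → insert (delete σ) ≡ σ
  insert∘delete (v ∷ τ) inj = cong (v ∷_) (≡-by-lookup _ τ (λ i → begin
    lookup (Vec.map (punchIn v) (Vec.map (deleteAt v) τ)) i
      ≡⟨ VecP.lookup-map i (punchIn v) (Vec.map (deleteAt v) τ) ⟩
    punchIn v (lookup (Vec.map (deleteAt v) τ) i)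
      ≡⟨ cong (punchIn v) (VecP.lookup-map i (deleteAt v) τ) ⟩
    punchIn v (deleteAt v (lookup τ i))
      ≡⟨ punchIn-deleteAt v _ (head≢ (v ∷ τ) inj i) ⟩
    lookup τ i ∎))

  delete∘insert : ∀ y → delete (insert y) ≡ y
  delete∘insert (v , τ) = cong (v ,_) (trans (sym (VecP.map-∘ (deleteAt v) (punchIn v) τ))
    (trans (VecP.map-cong (deleteAt-punchIn v) τ) (VecP.map-id τ)))

Rcoeff≡sumL : ∀ a b c d n k →
  Rcoeff a b c d n k ≡ sumL (allWords n n) (λ σ → ⟦ injective? σ ×-dec (mmp a b c d σ ℕ.≟ k) ⟧)
Rcoeff≡sumL a b c d n k = begin
  length (filter hasMmp? (filter distinct? σs))
    ≡⟨ length-filter≡sumL hasMmp? (filter distinct? σs) ⟩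
  sumL (filter distinct? σs) (λ σ → ⟦ hasMmp? σ ⟧)
    ≡⟨ sumL-filter distinct? σs _ ⟩
  sumL σs (λ σ → ⟦ distinct? σ ⟧ * ⟦ hasMmp? σ ⟧)
    ≡⟨ sumL-cong σs (λ σ → trans
         (cong (_* ⟦ hasMmp? σ ⟧)
               (⟦⟧-cong (distinct? σ) (injective? σ) (unique⇒injective σ) (injective⇒unique σ)))
         (sym (⟦×-dec⟧ (injective? σ) (hasMmp? σ)))) ⟩
  sumL σs (λ σ → ⟦ injective? σ ×-dec hasMmp? σ ⟧) ∎
  where
  open ≡-Reasoning
  σs : List (Vec (Fin n) n)
  σs = allWords n n
  distinct? : (σ : Vec (Fin n) n) → Dec (Unique (toList σ))
  distinct? σ = unique? FinP._≟_ (toList σ)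
  hasMmp? : (σ : Vec (Fin n) n) → Dec (mmp a b c d σ ≡ k)
  hasMmp? σ = mmp a b c d σ ℕ.≟ k

Rcoeff-above-bound : ∀ a b c d n {D k} → (∀ σ → mmp a b c d {n} σ ≤ D) → D < k → Rcoeff a b c d n k ≡ 0
Rcoeff-above-bound a b c d n {k = k} bound D<k = trans (Rcoeff≡sumL a b c d n k) (sumL-zero (allWords n n)
  (λ σ → ⟦⟧-no (injective? σ ×-dec (mmp a b c d σ ℕ.≟ k))
                (λ (_ , e) → <⇒≱ D<k (subst (_≤ _) e (bound σ)))))

module _ (σ : Vec (Fin n) n) where

  AboveRight AboveLeft BelowLeft BelowRight : Fin n → Set
  AboveRight i = ∃[ j ] (i Fin.< j × lookup σ i Fin.< lookup σ j)
  AboveLeft  i = ∃[ j ] (j Fin.< i × lookup σ i Fin.< lookup σ j)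
  BelowLeft  i = ∃[ j ] (j Fin.< i × lookup σ j Fin.< lookup σ i)
  BelowRight i = ∃[ j ] (i Fin.< j × lookup σ j Fin.< lookup σ i)

  aboveRight⁺ : ∀ i → 1 ≤ aboveRight σ i → AboveRight i
  aboveRight⁺ i = 1≤count⇒∃ (λ j → (i FinP.<? j) ×-dec (lookup σ i FinP.<? lookup σ j)) (allFin n)
  aboveLeft⁺ : ∀ i → 1 ≤ aboveLeft σ i → AboveLeft i
  aboveLeft⁺ i = 1≤count⇒∃ (λ j → (j FinP.<? i) ×-dec (lookup σ i FinP.<? lookup σ j)) (allFin n)
  belowLeft⁺ : ∀ i → 1 ≤ belowLeft σ i → BelowLeft i
  belowLeft⁺ i = 1≤count⇒∃ (λ j → (j FinP.<? i) ×-dec (lookup σ j FinP.<? lookup σ i)) (allFin n)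
  belowRight⁺ : ∀ i → 1 ≤ belowRight σ i → BelowRight i
  belowRight⁺ i = 1≤count⇒∃ (λ j → (i FinP.<? j) ×-dec (lookup σ j FinP.<? lookup σ i)) (allFin n)

  aboveRight⁻ : ∀ i → AboveRight i → 1 ≤ aboveRight σ i
  aboveRight⁻ i = ∃⇒1≤count (λ j → (i FinP.<? j) ×-dec (lookup σ i FinP.<? lookup σ j))
  aboveLeft⁻ : ∀ i → AboveLeft i → 1 ≤ aboveLeft σ i
  aboveLeft⁻ i = ∃⇒1≤count (λ j → (j FinP.<? i) ×-dec (lookup σ i FinP.<? lookup σ j))
  belowLeft⁻ : ∀ i → BelowLeft i → 1 ≤ belowLeft σ i
  belowLeft⁻ i = ∃⇒1≤count (λ j → (j FinP.<? i) ×-dec (lookup σ j FinP.<? lookup σ i))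
  belowRight⁻ : ∀ i → BelowRight i → 1 ≤ belowRight σ i
  belowRight⁻ i = ∃⇒1≤count (λ j → (i FinP.<? j) ×-dec (lookup σ j FinP.<? lookup σ i))

  first⇒¬BelowLeft : ∀ i → toℕ i ≡ 0 → ¬ BelowLeft i
  first⇒¬BelowLeft i i≡0 (j , j<i , _) = n≮0 (subst (toℕ j <_) i≡0 j<i)

  second⇒¬AboveLeft×BelowLeft : ∀ i → toℕ i ≡ 1 → ¬ (AboveLeft i × BelowLeft i)
  second⇒¬AboveLeft×BelowLeft i i≡1 ((j , j<i , σi<σj) , (j′ , j′<i , σj′<σi)) =
    <-asym σi<σj (subst (λ p → lookup σ p Fin.< lookup σ i) (sym j≡j′) σj′<σi)
    where
    first : ∀ p → p Fin.< i → toℕ p ≡ 0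
    first p p<i = n<1⇒n≡0 (subst (toℕ p <_) i≡1 p<i)
    j≡j′ : j ≡ j′
    j≡j′ = FinP.toℕ-injective (trans (first j j<i) (sym (first j′ j′<i)))

  last⇒¬AboveRight : ∀ i → suc (toℕ i) ≡ n → ¬ AboveRight i
  last⇒¬AboveRight i i+1≡n (j , i<j , _) =
    <-irrefl refl (≤-trans i<j (m<1+n⇒m≤n (subst (toℕ j <_) (sym i+1≡n) (FinP.toℕ<n j))))

  penultimate⇒¬AboveRight×BelowRight : ∀ i → suc (suc (toℕ i)) ≡ n → ¬ (AboveRight i × BelowRight i)
  penultimate⇒¬AboveRight×BelowRight i i+2≡n ((j , i<j , σi<σj) , (j′ , i<j′ , σj′<σi)) =
    <-asym σi<σj (subst (λ p → lookup σ p Fin.< lookup σ i) (sym j≡j′) σj′<σi)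
    where
    last : ∀ p → i Fin.< p → toℕ p ≡ suc (toℕ i)
    last p i<p = ≤-antisym (m<1+n⇒m≤n (subst (toℕ p <_) (sym i+2≡n) (FinP.toℕ<n p))) i<p
    j≡j′ : j ≡ j′
    j≡j′ = FinP.toℕ-injective (trans (last j i<j) (sym (last j′ i<j′)))

two-below⇒2≤ : {x y v : Fin n} → x ≢ y → x Fin.< v → y Fin.< v → 2 ≤ toℕ v
two-below⇒2≤ {x = x} {y} {v} x≢y x<v y<v with 2 ℕ.≤? toℕ v
... | yes 2≤v = 2≤v
... | no 2≰v = ⊥-elim (x≢y (FinP.toℕ-injective (trans (zero-below x<v) (sym (zero-below y<v)))))
  where
  zero-below : ∀ {z} → z Fin.< v → toℕ z ≡ 0
  zero-below z<v = n<1⇒n≡0 (≤-trans z<v (≤-pred (≰⇒> 2≰v)))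

two-above⇒3+≤ : {x y v : Fin n} → x ≢ y → v Fin.< x → v Fin.< y → 3 + toℕ v ≤ n
two-above⇒3+≤ {n} {x} {y} {v} x≢y v<x v<y with 3 + toℕ v ℕ.≤? n
... | yes fits = fits
... | no ¬fits = ⊥-elim (x≢y (FinP.toℕ-injective (trans (just-above v<x) (sym (just-above v<y)))))
  where
  just-above : ∀ {z : Fin n} → v Fin.< z → toℕ z ≡ suc (toℕ v)
  just-above {z} v<z = ≤-antisym (≤-pred (≤-trans (FinP.toℕ<n z) (≤-pred (≰⇒> ¬fits)))) v<z

record Splitting (N r m : ℕ) : Set where
  field
    outer : Fin r → Fin N
    inner : Fin m → Fin N
    split : Fin N → Fin r ⊎ Fin m
    split-outer : ∀ k → split (outer k) ≡ inj₁ k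
    split-inner : ∀ j → split (inner j) ≡ inj₂ j
    join-split  : ∀ i → [ outer , inner ]′ (split i) ≡ i

  split-injective : ∀ {i i′} → split i ≡ split i′ → i ≡ i′
  split-injective {i} {i′} e = trans (sym (join-split i)) (trans (cong [ outer , inner ]′ e) (join-split i′))

  outer-injective : ∀ {k k′} → outer k ≡ outer k′ → k ≡ k′
  outer-injective {k} {k′} e =
    Sum.inj₁-injective (trans (sym (split-outer k)) (trans (cong split e) (split-outer k′)))

  inner-injective : ∀ {j j′} → inner j ≡ inner j′ → j ≡ j′
  inner-injective {j} {j′} e =
    Sum.inj₂-injective (trans (sym (split-inner j)) (trans (cong split e) (split-inner j′)))

  outer≢inner : ∀ {k j} → outer k ≢ inner j
  outer≢inner {k} {j} e with trans (sym (split-outer k)) (trans (cong split e) (split-inner j))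
  ... | ()

  outer-or-inner : ∀ i → (∃[ k ] outer k ≡ i) ⊎ (∃[ j ] inner j ≡ i)
  outer-or-inner i with split i in e
  ... | inj₁ k = inj₁ (k , trans (cong [ outer , inner ]′ (sym e)) (join-split i))
  ... | inj₂ j = inj₂ (j , trans (cong [ outer , inner ]′ (sym e)) (join-split i))

-- A lower block of size a, an inner block of size b and an upper block of size c; the outer index
-- enumerates the lower block and then the upper block.
module ThreeBlock (a b c : ℕ) {N : ℕ} (a+b+c≡N : a + (b + c) ≡ N) where

  private
    embedOuter : Fin a ⊎ Fin c → Fin (a + (b + c))
    embedOuter = [ (_↑ˡ (b + c)) , (λ y → a ↑ʳ (b ↑ʳ y)) ]′

    join : Fin (a + c) ⊎ Fin b → Fin (a + (b + c))
    join (inj₁ k) = embedOuter (Fin.splitAt a k)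
    join (inj₂ j) = a ↑ʳ (j ↑ˡ c)

    split′ : Fin (a + (b + c)) → Fin (a + c) ⊎ Fin b
    split′ i = [ (λ x → inj₁ (x ↑ˡ c)) , (λ w → [ inj₂ , (λ y → inj₁ (a ↑ʳ y)) ]′ (Fin.splitAt b w)) ]′
                 (Fin.splitAt a i)

    split′-join : ∀ s → split′ (join s) ≡ s
    split′-join (inj₁ k) with Fin.splitAt a k in e
    ... | inj₁ x rewrite FinP.splitAt-↑ˡ a x (b + c) = cong inj₁ (FinP.splitAt⁻¹-↑ˡ e)
    ... | inj₂ y rewrite FinP.splitAt-↑ʳ a (b + c) (b ↑ʳ y) | FinP.splitAt-↑ʳ b c y =
      cong inj₁ (FinP.splitAt⁻¹-↑ʳ e)
    split′-join (inj₂ j) rewrite FinP.splitAt-↑ʳ a (b + c) (j ↑ˡ c) | FinP.splitAt-↑ˡ b j c = refl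

    join-split′ : ∀ i → [ join ∘ inj₁ , join ∘ inj₂ ]′ (split′ i) ≡ i
    join-split′ i with Fin.splitAt a i in e
    ... | inj₁ x rewrite FinP.splitAt-↑ˡ a x c = FinP.splitAt⁻¹-↑ˡ e
    ... | inj₂ w with Fin.splitAt b w in e′
    ...   | inj₁ j = trans (cong (a ↑ʳ_) (FinP.splitAt⁻¹-↑ˡ e′)) (FinP.splitAt⁻¹-↑ʳ e)
    ...   | inj₂ y rewrite FinP.splitAt-↑ʳ a c y =
      trans (cong (a ↑ʳ_) (FinP.splitAt⁻¹-↑ʳ e′)) (FinP.splitAt⁻¹-↑ʳ e)

  splitting : Splitting N (a + c) b
  splitting = record
    { outer = Fin.cast a+b+c≡N ∘ join ∘ inj₁
    ; inner = Fin.cast a+b+c≡N ∘ join ∘ inj₂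
    ; split = split′ ∘ Fin.cast (sym a+b+c≡N)
    ; split-outer = λ k → trans (cong split′ (uncast _)) (split′-join (inj₁ k))
    ; split-inner = λ j → trans (cong split′ (uncast _)) (split′-join (inj₂ j))
    ; join-split = λ i → trans (sym (Sum.[,]-∘ (Fin.cast a+b+c≡N) (split′ (Fin.cast (sym a+b+c≡N) i))))
        (trans (cong (Fin.cast a+b+c≡N) (join-split′ _)) (FinP.cast-involutive a+b+c≡N (sym a+b+c≡N) i))
    }
    where
    uncast : ∀ i → Fin.cast (sym a+b+c≡N) (Fin.cast a+b+c≡N i) ≡ i
    uncast = FinP.cast-involutive (sym a+b+c≡N) a+b+c≡N

  open Splitting splitting public

  Lower : Fin (a + c) → Set
  Lower k = toℕ k < a

  lower? : (k : Fin (a + c)) → Dec (Lower k)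
  lower? k = toℕ k ℕ.<? a

  private
    toℕ-embedOuter : ∀ s → toℕ (embedOuter s) ≡ [ toℕ , (λ y → a + (b + toℕ y)) ]′ s
    toℕ-embedOuter (inj₁ x) = FinP.toℕ-↑ˡ x (b + c)
    toℕ-embedOuter (inj₂ y) = trans (FinP.toℕ-↑ʳ a (b ↑ʳ y)) (cong (a +_) (FinP.toℕ-↑ʳ b y))

    toℕ-outer′ : ∀ k → toℕ (outer k) ≡ [ toℕ , (λ y → a + (b + toℕ y)) ]′ (Fin.splitAt a k)
    toℕ-outer′ k = trans (FinP.toℕ-cast a+b+c≡N _) (toℕ-embedOuter (Fin.splitAt a k))

  toℕ-inner : ∀ j → toℕ (inner j) ≡ a + toℕ j
  toℕ-inner j =
    trans (FinP.toℕ-cast a+b+c≡N _) (trans (FinP.toℕ-↑ʳ a (j ↑ˡ c)) (cong (a +_) (FinP.toℕ-↑ˡ j c)))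

  toℕ-outer-lower : ∀ k → Lower k → toℕ (outer k) ≡ toℕ k
  toℕ-outer-lower k lower = trans (toℕ-outer′ k)
    (trans (cong [ toℕ , (λ y → a + (b + toℕ y)) ]′ (FinP.splitAt-< a k lower)) (FinP.toℕ-fromℕ< lower))

  toℕ-outer-upper : ∀ k → ¬ Lower k → toℕ (outer k) ≡ b + toℕ k
  toℕ-outer-upper k upper with Fin.splitAt a k in e
  ... | inj₁ x = ⊥-elim (upper (subst (_< a) (trans (sym (FinP.toℕ-↑ˡ x c)) (cong toℕ (FinP.splitAt⁻¹-↑ˡ e)))
                                              (FinP.toℕ<n x)))
  ... | inj₂ y = begin
    toℕ (Fin.cast a+b+c≡N (a ↑ʳ (b ↑ʳ y))) ≡⟨ trans (FinP.toℕ-cast a+b+c≡N _) (toℕ-embedOuter (inj₂ y)) ⟩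
    a + (b + toℕ y)                         ≡⟨ x∙yz≈y∙xz a b (toℕ y) ⟩
    b + (a + toℕ y)                         ≡⟨ cong (b +_) (trans (sym (FinP.toℕ-↑ʳ a y))
                                                                  (cong toℕ (FinP.splitAt⁻¹-↑ʳ e))) ⟩
    b + toℕ k                               ∎
    where open ≡-Reasoning

  lower<inner : ∀ k j → Lower k → toℕ (outer k) < toℕ (inner j)
  lower<inner k j lower =
    subst₂ _<_ (sym (toℕ-outer-lower k lower)) (sym (toℕ-inner j)) (≤-trans lower (m≤m+n a (toℕ j)))

  inner<upper : ∀ k j → ¬ Lower k → toℕ (inner j) < toℕ (outer k)
  inner<upper k j upper = subst₂ _<_ (sym (toℕ-inner j)) (sym (toℕ-outer-upper k upper))
    (≤-trans (+-monoʳ-< a (FinP.toℕ<n j)) (subst (_≤ b + toℕ k) (+-comm b a) (+-monoʳ-≤ b (≮⇒≥ upper))))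

  outer<inner⇒lower : ∀ k j → toℕ (outer k) < toℕ (inner j) → Lower k
  outer<inner⇒lower k j lt with lower? k
  ... | yes lower = lower
  ... | no upper  = ⊥-elim (<-asym lt (inner<upper k j upper))

  inner<outer⇒upper : ∀ k j → toℕ (inner j) < toℕ (outer k) → ¬ Lower k
  inner<outer⇒upper k j lt lower = <-asym lt (lower<inner k j lower)

  below-inner⇒lower : ∀ i → toℕ i < a → ∃[ k ] Lower k × outer k ≡ i
  below-inner⇒lower i i<a with outer-or-inner i
  ... | inj₂ (j , refl) = ⊥-elim (≤⇒≯ (subst (a ≤_) (sym (toℕ-inner j)) (m≤m+n a _)) i<a)
  ... | inj₁ (k , refl) with lower? k
  ...   | yes lower = k , lower , refl
  ...   | no upper  =
    ⊥-elim (≤⇒≯ (subst (a ≤_) (sym (toℕ-outer-upper k upper)) (≤-trans (≮⇒≥ upper) (m≤n+m _ b))) i<a)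

  above-inner⇒upper : ∀ i → a + b ≤ toℕ i → ∃[ k ] ¬ Lower k × outer k ≡ i
  above-inner⇒upper i a+b≤i with outer-or-inner i
  ... | inj₂ (j , refl) =
    ⊥-elim (≤⇒≯ a+b≤i (subst (_< a + b) (sym (toℕ-inner j)) (+-monoʳ-< a (FinP.toℕ<n j))))
  ... | inj₁ (k , refl) with lower? k
  ...   | no upper  = k , upper , refl
  ...   | yes lower =
    ⊥-elim (≤⇒≯ a+b≤i (subst (_< a + b) (sym (toℕ-outer-lower k lower)) (≤-trans lower (m≤m+n a b))))

  within⇒inner : ∀ i → a ≤ toℕ i → toℕ i < a + b → ∃[ j ] inner j ≡ i
  within⇒inner i a≤i i<a+b with outer-or-inner i
  ... | inj₂ hit = hit
  ... | inj₁ (k , refl) with lower? k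
  ...   | yes lower = ⊥-elim (≤⇒≯ a≤i (subst (_< a) (sym (toℕ-outer-lower k lower)) lower))
  ...   | no upper  = ⊥-elim (≤⇒≯ (subst (a + b ≤_) (sym (toℕ-outer-upper k upper))
                          (subst (_≤ b + toℕ k) (+-comm b a) (+-monoʳ-≤ b (≮⇒≥ upper)))) i<a+b)

  sum-inner : (f : Fin N → ℕ) → (∀ k → f (outer k) ≡ 0) → sum f ≡ sum (f ∘ inner)
  sum-inner f outer-vanishes = begin
    sum f
      ≡⟨ sum-cast a+b+c≡N f ⟩
    sum g
      ≡⟨ sum-↑ {a} {b + c} g ⟩
    sum {a} (g ∘ (_↑ˡ (b + c))) + sum (g ∘ (a ↑ʳ_))
      ≡⟨ cong₂ _+_ (sum-zero {a} lower-vanishes) (sum-↑ {b} {c} (g ∘ (a ↑ʳ_))) ⟩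
    sum (f ∘ inner) + sum {c} (g ∘ (a ↑ʳ_) ∘ (b ↑ʳ_))
      ≡⟨ cong (sum (f ∘ inner) +_) (sum-zero {c} upper-vanishes) ⟩
    sum (f ∘ inner) + 0
      ≡⟨ +-identityʳ _ ⟩
    sum (f ∘ inner) ∎
    where
    open ≡-Reasoning
    g : Fin (a + (b + c)) → ℕ
    g = f ∘ Fin.cast a+b+c≡N
    lower-vanishes : ∀ x → g (x ↑ˡ (b + c)) ≡ 0
    lower-vanishes x = trans (cong (g ∘ embedOuter) (sym (FinP.splitAt-↑ˡ a x c))) (outer-vanishes (x ↑ˡ c))
    upper-vanishes : ∀ y → g (a ↑ʳ (b ↑ʳ y)) ≡ 0
    upper-vanishes y = trans (cong (g ∘ embedOuter) (sym (FinP.splitAt-↑ʳ a c y))) (outer-vanishes (a ↑ʳ y))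

-- A permutation sending the inner positions of P to the inner values of V is the same thing as a
-- pair of permutations: one of the outer block, one of the inner block.
module Decomposition {N r m : ℕ} (P V : Splitting N r m) where

  private
    module P = Splitting P
    module V = Splitting V

  PreservesInner : Vec (Fin N) N → Set
  PreservesInner σ = ∀ j → ∃[ j′ ] V.split (lookup σ (P.inner j)) ≡ inj₂ j′

  preservesInner? : (σ : Vec (Fin N) N) → Dec (PreservesInner σ)
  preservesInner? σ = FinP.all? (λ j → isInj₂? (V.split (lookup σ (P.inner j))))
    where
    isInj₂? : (s : Fin r ⊎ Fin m) → Dec (∃[ j′ ] s ≡ inj₂ j′)
    isInj₂? (inj₁ _)  = no λ { (_ , ()) }
    isInj₂? (inj₂ j′) = yes (j′ , refl)

  outerPattern : Vec (Fin N) N → Vec (Fin r) r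
  outerPattern σ = tabulate (λ k → [ id , (λ _ → k) ]′ (V.split (lookup σ (P.outer k))))

  innerPattern : Vec (Fin N) N → Vec (Fin m) m
  innerPattern σ = tabulate (λ j → [ (λ _ → j) , id ]′ (V.split (lookup σ (P.inner j))))

  assemble : Vec (Fin r) r × Vec (Fin m) m → Vec (Fin N) N
  assemble (π , τ) = tabulate (λ i → [ V.outer ∘ lookup π , V.inner ∘ lookup τ ]′ (P.split i))

  module _ (σ : Vec (Fin N) N) (injective : IsInjective σ) (preserves : PreservesInner σ) where

    private
      innerImage : Fin m → Fin m
      innerImage = proj₁ ∘ preserves

      innerImage-injective : Injective _≡_ _≡_ innerImage
      innerImage-injective {j₁} {j₂} e = P.inner-injective (injective (V.split-injective
        (trans (proj₂ (preserves j₁)) (trans (cong inj₂ e) (sym (proj₂ (preserves j₂)))))))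

    -- The inner values are all taken by inner positions, so outer positions get outer values.
    preservesOuter : ∀ k → ∃[ k′ ] V.split (lookup σ (P.outer k)) ≡ inj₁ k′
    preservesOuter k with V.split (lookup σ (P.outer k)) in e
    ... | inj₁ k′ = k′ , refl
    ... | inj₂ j′ with injective⇒surjective innerImage innerImage-injective j′
    ...   | j , innerImage-j≡j′ = ⊥-elim (P.outer≢inner (injective (V.split-injective
            (trans e (sym (trans (proj₂ (preserves j)) (cong inj₂ innerImage-j≡j′)))))))

    lookup-outer : ∀ k → lookup σ (P.outer k) ≡ V.outer (lookup (outerPattern σ) k)
    lookup-outer k with preservesOuter k
    ... | k′ , e = begin
      lookup σ (P.outer k)                                    ≡⟨ V.join-split _ ⟨
      [ V.outer , V.inner ]′ (V.split (lookup σ (P.outer k))) ≡⟨ cong [ V.outer , V.inner ]′ e ⟩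
      V.outer k′                                              ≡⟨ cong V.outer (trans (VecP.lookup∘tabulate _ k)
                                                                                     (cong [ id , (λ _ → k) ]′ e)) ⟨
      V.outer (lookup (outerPattern σ) k)                     ∎
      where open ≡-Reasoning

    lookup-inner : ∀ j → lookup σ (P.inner j) ≡ V.inner (lookup (innerPattern σ) j)
    lookup-inner j with preserves j
    ... | j′ , e = begin
      lookup σ (P.inner j)                                    ≡⟨ V.join-split _ ⟨
      [ V.outer , V.inner ]′ (V.split (lookup σ (P.inner j))) ≡⟨ cong [ V.outer , V.inner ]′ e ⟩
      V.inner j′                                              ≡⟨ cong V.inner (trans (VecP.lookup∘tabulate _ j)
                                                                                     (cong [ (λ _ → j) , id ]′ e)) ⟨
      V.inner (lookup (innerPattern σ) j)                     ∎
      where open ≡-Reasoning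

    outerPattern-injective : IsInjective (outerPattern σ)
    outerPattern-injective {k} {k′} e =
      P.outer-injective (injective (trans (lookup-outer k) (trans (cong V.outer e) (sym (lookup-outer k′)))))

    innerPattern-injective : IsInjective (innerPattern σ)
    innerPattern-injective {j} {j′} e =
      P.inner-injective (injective (trans (lookup-inner j) (trans (cong V.inner e) (sym (lookup-inner j′)))))

    assemble-patterns : assemble (outerPattern σ , innerPattern σ) ≡ σ
    assemble-patterns = ≡-by-lookup _ σ entry
      where
      entry : ∀ i → lookup (assemble (outerPattern σ , innerPattern σ)) i ≡ lookup σ i
      entry i with P.outer-or-inner i
      ... | inj₁ (k , refl) = trans (VecP.lookup∘tabulate _ (P.outer k))
                                (trans (cong [ _ , _ ]′ (P.split-outer k)) (sym (lookup-outer k)))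
      ... | inj₂ (j , refl) = trans (VecP.lookup∘tabulate _ (P.inner j))
                                (trans (cong [ _ , _ ]′ (P.split-inner j)) (sym (lookup-inner j)))

  module _ (π : Vec (Fin r) r) (τ : Vec (Fin m) m) where

    lookup-assemble-outer : ∀ k → lookup (assemble (π , τ)) (P.outer k) ≡ V.outer (lookup π k)
    lookup-assemble-outer k =
      trans (VecP.lookup∘tabulate _ (P.outer k)) (cong [ V.outer ∘ lookup π , V.inner ∘ lookup τ ]′ (P.split-outer k))

    lookup-assemble-inner : ∀ j → lookup (assemble (π , τ)) (P.inner j) ≡ V.inner (lookup τ j)
    lookup-assemble-inner j =
      trans (VecP.lookup∘tabulate _ (P.inner j)) (cong [ V.outer ∘ lookup π , V.inner ∘ lookup τ ]′ (P.split-inner j))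

    assemble-preservesInner : PreservesInner (assemble (π , τ))
    assemble-preservesInner j = lookup τ j , trans (cong V.split (lookup-assemble-inner j)) (V.split-inner _)

    outerPattern-assemble : outerPattern (assemble (π , τ)) ≡ π
    outerPattern-assemble = ≡-by-lookup _ π λ k → trans (VecP.lookup∘tabulate _ k)
      (cong [ id , (λ _ → k) ]′ (trans (cong V.split (lookup-assemble-outer k)) (V.split-outer _)))

    innerPattern-assemble : innerPattern (assemble (π , τ)) ≡ τ
    innerPattern-assemble = ≡-by-lookup _ τ λ j → trans (VecP.lookup∘tabulate _ j)
      (cong [ (λ _ → j) , id ]′ (trans (cong V.split (lookup-assemble-inner j)) (V.split-inner _)))

    assemble-injective : IsInjective π → IsInjective τ → IsInjective (assemble (π , τ))
    assemble-injective inj-π inj-τ {i} {i′} e with P.outer-or-inner i | P.outer-or-inner i′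
    ... | inj₁ (k , refl) | inj₁ (k′ , refl) = cong P.outer (inj-π (V.outer-injective
            (trans (sym (lookup-assemble-outer k)) (trans e (lookup-assemble-outer k′)))))
    ... | inj₁ (k , refl) | inj₂ (j′ , refl) = ⊥-elim (V.outer≢inner
            (trans (sym (lookup-assemble-outer k)) (trans e (lookup-assemble-inner j′))))
    ... | inj₂ (j , refl) | inj₁ (k′ , refl) = ⊥-elim (V.outer≢inner
            (trans (sym (lookup-assemble-outer k′)) (trans (sym e) (lookup-assemble-inner j))))
    ... | inj₂ (j , refl) | inj₂ (j′ , refl) = cong P.inner (inj-τ (V.inner-injective
            (trans (sym (lookup-assemble-inner j)) (trans e (lookup-assemble-inner j′)))))

  count-decomposition : {C : Pred (Vec (Fin r) r) 0ℓ} (C? : Decidable C) →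
    sumL (allWords N N) (λ σ → ⟦ injective? σ ×-dec preservesInner? σ ×-dec C? (outerPattern σ) ⟧)
      ≡ sumL (allWords r r) (λ π → ⟦ injective? π ×-dec C? π ⟧) * m !
  count-decomposition {C} C? = begin
    sumL (allWords N N) (λ σ → ⟦ injective? σ ×-dec preservesInner? σ ×-dec C? (outerPattern σ) ⟧)
      ≡⟨ count-transfer (allWords N N) (pairs (allWords r r) (allWords m m))
           (VecP.≡-dec FinP._≟_) (ProdP.≡-dec (VecP.≡-dec FinP._≟_) (VecP.≡-dec FinP._≟_))
           (enumerates-allWords N N)
           (enumerates-pairs (allWords r r) (allWords m m) (VecP.≡-dec FinP._≟_) (VecP.≡-dec FinP._≟_)
              (enumerates-allWords r r) (enumerates-allWords m m))
           _ Q? (λ σ → outerPattern σ , innerPattern σ) assemble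
           (λ { σ (inj , pres , c) →
                  (outerPattern-injective σ inj pres , c) , innerPattern-injective σ inj pres })
           (λ { (π , τ) ((inj-π , c) , inj-τ) →
                  assemble-injective π τ inj-π inj-τ , assemble-preservesInner π τ ,
                  subst C (sym (outerPattern-assemble π τ)) c })
           (λ { σ (inj , pres , _) → assemble-patterns σ inj pres })
           (λ { (π , τ) _ → cong₂ _,_ (outerPattern-assemble π τ) (innerPattern-assemble π τ) }) ⟩
    sumL (pairs (allWords r r) (allWords m m)) (λ y → ⟦ Q? y ⟧)
      ≡⟨ sumL-pairs-⟦×-dec⟧ (allWords r r) (allWords m m) (λ π → injective? π ×-dec C? π) injective? ⟩
    sumL (allWords r r) (λ π → ⟦ injective? π ×-dec C? π ⟧) * sumL (allWords m m) (λ τ → ⟦ injective? τ ⟧)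
      ≡⟨ cong (sumL (allWords r r) (λ π → ⟦ injective? π ×-dec C? π ⟧) *_) (count-injective m) ⟩
    sumL (allWords r r) (λ π → ⟦ injective? π ×-dec C? π ⟧) * m ! ∎
    where
    open ≡-Reasoning
    Q? : (y : Vec (Fin r) r × Vec (Fin m) m) →
         Dec ((IsInjective (proj₁ y) × C (proj₁ y)) × IsInjective (proj₂ y))
    Q? y = (injective? (proj₁ y) ×-dec C? (proj₁ y)) ×-dec injective? (proj₂ y)

matches? : ∀ a b c d (σ : Vec (Fin n) n) i → Dec (MatchesMMP a b c d σ i)
matches? a b c d σ i =
  (a ℕ.≤? aboveRight σ i) ×-dec (b ℕ.≤? aboveLeft σ i) ×-dec
  (c ℕ.≤? belowLeft σ i) ×-dec (d ℕ.≤? belowRight σ i)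

mmp≡sum : ∀ a b c d (σ : Vec (Fin n) n) → mmp a b c d σ ≡ sum (λ i → ⟦ matches? a b c d σ i ⟧)
mmp≡sum a b c d σ = count≡sum (matches? a b c d σ)

sum-⟦⟧≤ : {R : Pred (Fin k) 0ℓ} (R? : Decidable R) → sum (λ j → ⟦ R? j ⟧) ≤ k
sum-⟦⟧≤ R? = sum-≤ (λ j → ⟦⟧≤1 (R? j))

sum-⟦⟧≡⇒ : {R : Pred (Fin k) 0ℓ} (R? : Decidable R) → sum (λ j → ⟦ R? j ⟧) ≡ k → ∀ j → R j
sum-⟦⟧≡⇒ R? e j = ⟦⟧≡1⇒ (R? j) (sum≡n⇒ (λ j → ⟦⟧≤1 (R? j)) e j)

sum-⟦⟧≡⇐ : {R : Pred (Fin k) 0ℓ} (R? : Decidable R) → (∀ j → R j) → sum (λ j → ⟦ R? j ⟧) ≡ k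
sum-⟦⟧≡⇐ {k} R? all =
  trans (sum-cong-≗ (λ j → ⟦⟧-yes (R? j) (all j))) (trans (sum-const {k} 1) (*-identityʳ k))

hasDegreeLeading : ∀ a b c d n {D L} → (∀ σ → mmp a b c d {n} σ ≤ D) → Rcoeff a b c d n D ≡ L → L ≢ 0 →
                   HasDegreeLeading a b c d n D L
hasDegreeLeading a b c d n bound leading L≢0 = leading , L≢0 , λ k D<k → Rcoeff-above-bound a b c d n bound D<k

module InnerCount (a b c d : ℕ) (lo mid hi : ℕ) {N : ℕ} (lo+mid+hi≡N : lo + (mid + hi) ≡ N)
  (outer-unmatched : ∀ σ k → ¬ MatchesMMP a b c d σ (ThreeBlock.outer lo mid hi lo+mid+hi≡N k)) where

  private
    module Pos = ThreeBlock lo mid hi lo+mid+hi≡N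

  mmp≡inner : ∀ σ → mmp a b c d σ ≡ sum (λ j → ⟦ matches? a b c d σ (Pos.inner j) ⟧)
  mmp≡inner σ = trans (mmp≡sum a b c d σ)
    (Pos.sum-inner _ (λ k → ⟦⟧-no (matches? a b c d σ (Pos.outer k)) (outer-unmatched σ k)))

  mmp≤ : ∀ σ → mmp a b c d σ ≤ mid
  mmp≤ σ = subst (_≤ mid) (sym (mmp≡inner σ)) (sum-⟦⟧≤ (matches? a b c d σ ∘ Pos.inner))

  mmp≡⇒ : ∀ σ → mmp a b c d σ ≡ mid → ∀ j → MatchesMMP a b c d σ (Pos.inner j)
  mmp≡⇒ σ e = sum-⟦⟧≡⇒ (matches? a b c d σ ∘ Pos.inner) (trans (sym (mmp≡inner σ)) e)

  mmp≡⇐ : ∀ σ → (∀ j → MatchesMMP a b c d σ (Pos.inner j)) → mmp a b c d σ ≡ mid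
  mmp≡⇐ σ all = trans (mmp≡inner σ) (sum-⟦⟧≡⇐ (matches? a b c d σ ∘ Pos.inner) all)

distinct-values : {σ : Vec (Fin n) n} → IsInjective σ →
                  ∀ p i q → p Fin.< i → i Fin.< q → lookup σ p ≢ lookup σ q
distinct-values inj p i q p<i i<q e = FinP.<⇒≢ (FinP.<-trans p<i i<q) (inj e)

LowValue : Fin k → Set
LowValue x = toℕ x < 2

lowValue? : (x : Fin k) → Dec (LowValue x)
lowValue? x = toℕ x ℕ.<? 2

Mixed : Fin k → Fin k → Set
Mixed x y = (LowValue x × ¬ LowValue y) ⊎ (¬ LowValue x × LowValue y)

mixed? : (x y : Fin k) → Dec (Mixed x y)
mixed? x y = (lowValue? x ×-dec ¬? (lowValue? y)) ⊎-dec (¬? (lowValue? x) ×-dec lowValue? y)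

mixed-intro : (x y : Fin k) {k₁ k₂ : Fin k} (π : Vec (Fin k) k) → k₁ ≡ x ⊎ k₁ ≡ y → k₂ ≡ x ⊎ k₂ ≡ y →
              ¬ LowValue (lookup π k₁) → LowValue (lookup π k₂) → Mixed (lookup π x) (lookup π y)
mixed-intro x y π (inj₁ refl) (inj₁ refl) high low = ⊥-elim (high low)
mixed-intro x y π (inj₁ refl) (inj₂ refl) high low = inj₂ (high , low)
mixed-intro x y π (inj₂ refl) (inj₁ refl) high low = inj₁ (low , high)
mixed-intro x y π (inj₂ refl) (inj₂ refl) high low = ⊥-elim (high low)

-- Values: 0, 1 (low) | 2 … m+1 (inner) | h high ones.
module Layout (h m : ℕ) {N : ℕ} (val-sizes : 2 + (m + h) ≡ N) (P : Splitting N (2 + h) m) where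

  module Val = ThreeBlock 2 m h val-sizes
  private
    module P = Splitting P
  open Decomposition P Val.splitting public

  inner-value : ∀ v → 2 ≤ toℕ v → toℕ v < 2 + m → ∃[ j′ ] Val.split v ≡ inj₂ j′
  inner-value v 2≤v v<2+m with Val.within⇒inner v 2≤v v<2+m
  ... | j′ , refl = j′ , Val.split-inner j′

  module Compare (σ : Vec (Fin N) N) (inj : IsInjective σ) (preserves : PreservesInner σ) where

    private
      π : Vec (Fin (2 + h)) (2 + h)
      π = outerPattern σ
      σ-outer : ∀ k → lookup σ (P.outer k) ≡ Val.outer (lookup π k)
      σ-outer = lookup-outer σ inj preserves
      σ-inner : ∀ j → lookup σ (P.inner j) ≡ Val.inner (lookup (innerPattern σ) j)
      σ-inner = lookup-inner σ inj preserves

    below⇒low : ∀ k j → lookup σ (P.outer k) Fin.< lookup σ (P.inner j) → LowValue (lookup π k)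
    below⇒low k j lt = Val.outer<inner⇒lower (lookup π k) (lookup (innerPattern σ) j)
      (subst₂ (λ x y → toℕ x < toℕ y) (σ-outer k) (σ-inner j) lt)

    above⇒high : ∀ k j → lookup σ (P.inner j) Fin.< lookup σ (P.outer k) → ¬ LowValue (lookup π k)
    above⇒high k j lt = Val.inner<outer⇒upper (lookup π k) (lookup (innerPattern σ) j)
      (subst₂ (λ x y → toℕ x < toℕ y) (σ-inner j) (σ-outer k) lt)

    low⇒below : ∀ k j → LowValue (lookup π k) → lookup σ (P.outer k) Fin.< lookup σ (P.inner j)
    low⇒below k j low = subst₂ (λ x y → toℕ x < toℕ y) (sym (σ-outer k)) (sym (σ-inner j))
      (Val.lower<inner (lookup π k) (lookup (innerPattern σ) j) low)

    high⇒above : ∀ k j → ¬ LowValue (lookup π k) → lookup σ (P.inner j) Fin.< lookup σ (P.outer k)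
    high⇒above k j high = subst₂ (λ x y → toℕ x < toℕ y) (sym (σ-inner j)) (sym (σ-outer k))
      (Val.inner<upper (lookup π k) (lookup (innerPattern σ) j) high)

  count-maximal : ∀ a b c d {C : Pred (Vec (Fin (2 + h)) (2 + h)) 0ℓ} (C? : Decidable C) →
    (∀ σ → IsInjective σ → mmp a b c d σ ≡ m → PreservesInner σ × C (outerPattern σ)) →
    (∀ σ → IsInjective σ → PreservesInner σ → C (outerPattern σ) → mmp a b c d σ ≡ m) →
    Rcoeff a b c d N m ≡ sumL (allWords (2 + h) (2 + h)) (λ π → ⟦ injective? π ×-dec C? π ⟧) * m !
  count-maximal a b c d C? maximal⇒ maximal⇐ = begin
    Rcoeff a b c d N m
      ≡⟨ Rcoeff≡sumL a b c d N m ⟩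
    sumL (allWords N N) (λ σ → ⟦ injective? σ ×-dec (mmp a b c d σ ℕ.≟ m) ⟧)
      ≡⟨ sumL-cong (allWords N N) (λ σ → ⟦⟧-cong (injective? σ ×-dec (mmp a b c d σ ℕ.≟ m))
           (injective? σ ×-dec preservesInner? σ ×-dec C? (outerPattern σ))
           (λ (inj , e) → inj , maximal⇒ σ inj e) (λ (inj , pres , c) → inj , maximal⇐ σ inj pres c)) ⟩
    sumL (allWords N N) (λ σ → ⟦ injective? σ ×-dec preservesInner? σ ×-dec C? (outerPattern σ) ⟧)
      ≡⟨ count-decomposition C? ⟩
    sumL (allWords (2 + h) (2 + h)) (λ π → ⟦ injective? π ×-dec C? π ⟧) * m ! ∎
    where open ≡-Reasoning

-- Positions: 0 | 1 … m | m+1, m+2.  Values: 0, 1 | 2 … m+1 | m+2.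
module MaximalMMP1011 (k : ℕ) where

  m N : ℕ
  m = suc k
  N = 3 + m

  pos-sizes : 1 + (m + 2) ≡ N
  pos-sizes = cong suc (+-comm m 2)

  module Pos = ThreeBlock 1 m 2 pos-sizes
  open Layout 1 m (cong (2 +_) (+-comm m 1)) Pos.splitting

  Matches : Vec (Fin N) N → Fin N → Set
  Matches σ i = AboveRight σ i × BelowLeft σ i × BelowRight σ i

  matchesMMP⇒ : ∀ σ i → MatchesMMP 1 0 1 1 σ i → Matches σ i
  matchesMMP⇒ σ i (ar , _ , bl , br) = aboveRight⁺ σ i ar , belowLeft⁺ σ i bl , belowRight⁺ σ i br

  ⇒matchesMMP : ∀ σ i → Matches σ i → MatchesMMP 1 0 1 1 σ i
  ⇒matchesMMP σ i (ar , bl , br) = aboveRight⁻ σ i ar , z≤n , belowLeft⁻ σ i bl , belowRight⁻ σ i br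

  outer-unmatched : ∀ σ k → ¬ MatchesMMP 1 0 1 1 σ (Pos.outer k)
  outer-unmatched σ 0F match with matchesMMP⇒ σ _ match
  ... | _ , bl , _ = first⇒¬BelowLeft σ _ (Pos.toℕ-outer-lower 0F (s≤s z≤n)) bl
  outer-unmatched σ 1F match with matchesMMP⇒ σ _ match
  ... | ar , _ , br = penultimate⇒¬AboveRight×BelowRight σ _
          (cong (suc ∘ suc) (trans (Pos.toℕ-outer-upper 1F λ { (s≤s ()) }) (+-comm m 1))) (ar , br)
  outer-unmatched σ 2F match with matchesMMP⇒ σ _ match
  ... | ar , _ , _ =
    last⇒¬AboveRight σ _ (cong suc (trans (Pos.toℕ-outer-upper 2F λ { (s≤s ()) }) (+-comm m 2))) ar

  open InnerCount 1 0 1 1 1 m 2 pos-sizes outer-unmatched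

  MaxPattern : Vec (Fin 3) 3 → Set
  MaxPattern π = LowValue (lookup π 0F) × Mixed (lookup π 1F) (lookup π 2F)

  maxPattern? : (π : Vec (Fin 3) 3) → Dec (MaxPattern π)
  maxPattern? π = lowValue? (lookup π 0F) ×-dec mixed? (lookup π 1F) (lookup π 2F)

  inner-values : ∀ σ → IsInjective σ → (∀ j → Matches σ (Pos.inner j)) → PreservesInner σ
  inner-values σ inj all j with all j
  ... | (q , _ , σi<σq) , (p , p<i , σp<σi) , (p′ , i<p′ , σp′<σi) =
    inner-value (lookup σ (Pos.inner j))
      (two-below⇒2≤ (distinct-values {σ = σ} inj p (Pos.inner j) p′ p<i i<p′) σp<σi σp′<σi)
      (≤-trans σi<σq (m<1+n⇒m≤n (FinP.toℕ<n (lookup σ q))))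

  module _ (σ : Vec (Fin N) N) (inj : IsInjective σ) (preserves : PreservesInner σ) where

    open Compare σ inj preserves

    π : Vec (Fin 3) 3
    π = outerPattern σ

    right-outer : ∀ {k} → ¬ Pos.Lower k → k ≡ 1F ⊎ k ≡ 2F
    right-outer {0F} upper = ⊥-elim (upper (s≤s z≤n))
    right-outer {1F} _ = inj₁ refl
    right-outer {2F} _ = inj₂ refl

    last-inner : ∀ {q : Fin N} → Pos.inner (Fin.fromℕ k) Fin.< q → 1 + m ≤ toℕ q
    last-inner {q} =
      subst (λ t → suc t ≤ toℕ q) (trans (Pos.toℕ-inner (Fin.fromℕ k)) (cong suc (FinP.toℕ-fromℕ k)))

    maxPattern : (∀ j → Matches σ (Pos.inner j)) → MaxPattern π
    maxPattern all = first-low , last-mixed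
      where
      first-low : LowValue (lookup π 0F)
      first-low with all 0F
      ... | _ , (p , p<i , σp<σi) , _ with Pos.below-inner⇒lower p (subst (toℕ p <_) (Pos.toℕ-inner 0F) p<i)
      ...   | k , lower , refl with FinP.toℕ-injective {i = k} {j = 0F} (n<1⇒n≡0 lower)
      ...     | refl = below⇒low 0F 0F σp<σi
      last-mixed : Mixed (lookup π 1F) (lookup π 2F)
      last-mixed with all (Fin.fromℕ k)
      ... | (q , i<q , σi<σq) , _ , (q′ , i<q′ , σq′<σi)
        with Pos.above-inner⇒upper q (last-inner {q} i<q) | Pos.above-inner⇒upper q′ (last-inner {q′} i<q′)
      ... | k₁ , upper₁ , refl | k₂ , upper₂ , refl =
        mixed-intro 1F 2F π (right-outer upper₁) (right-outer upper₂)
          (above⇒high k₁ (Fin.fromℕ k) σi<σq) (below⇒low k₂ (Fin.fromℕ k) σq′<σi)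

    allMatch : MaxPattern π → ∀ j → Matches σ (Pos.inner j)
    allMatch (first-low , last-mixed) j =
      proj₁ (right-witnesses last-mixed) , left-witness , proj₂ (right-witnesses last-mixed)
      where
      left-witness : BelowLeft σ (Pos.inner j)
      left-witness = Pos.outer 0F , Pos.lower<inner 0F j (s≤s z≤n) , low⇒below 0F j first-low
      right-witnesses : Mixed (lookup π 1F) (lookup π 2F) →
                        AboveRight σ (Pos.inner j) × BelowRight σ (Pos.inner j)
      right-witnesses (inj₁ (low , high)) =
        (Pos.outer 2F , Pos.inner<upper 2F j (λ { (s≤s ()) }) , high⇒above 2F j high) ,
        (Pos.outer 1F , Pos.inner<upper 1F j (λ { (s≤s ()) }) , low⇒below 1F j low)
      right-witnesses (inj₂ (high , low)) =
        (Pos.outer 1F , Pos.inner<upper 1F j (λ { (s≤s ()) }) , high⇒above 1F j high) ,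
        (Pos.outer 2F , Pos.inner<upper 2F j (λ { (s≤s ()) }) , low⇒below 2F j low)

  maximal⇒ : ∀ σ → IsInjective σ → mmp 1 0 1 1 σ ≡ m → PreservesInner σ × MaxPattern (outerPattern σ)
  maximal⇒ σ inj e = preserves , maxPattern σ inj preserves all
    where
    all : ∀ j → Matches σ (Pos.inner j)
    all j = matchesMMP⇒ σ _ (mmp≡⇒ σ e j)
    preserves : PreservesInner σ
    preserves = inner-values σ inj all

  maximal⇐ : ∀ σ → IsInjective σ → PreservesInner σ → MaxPattern (outerPattern σ) → mmp 1 0 1 1 σ ≡ m
  maximal⇐ σ inj preserves max = mmp≡⇐ σ (λ j → ⇒matchesMMP σ _ (allMatch σ inj preserves max j))

  max-patterns : sumL (allWords 3 3) (λ π → ⟦ injective? π ×-dec maxPattern? π ⟧) ≡ 4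
  max-patterns = refl

  count : Rcoeff 1 0 1 1 N m ≡ 4 * m !
  count = trans (count-maximal 1 0 1 1 maxPattern? maximal⇒ maximal⇐) (cong (_* m !) max-patterns)

  degree : HasDegreeLeading 1 0 1 1 N m (4 * m !)
  degree = hasDegreeLeading 1 0 1 1 N mmp≤ count (≢-nonZero⁻¹ (4 * m !) {{m*n≢0 4 (m !) {{_}} {{m !≢0}}}})

-- Positions: 0, 1 | 2 … m+1 | m+2, m+3.  Values: 0, 1 | 2 … m+1 | m+2, m+3.
module MaximalMMP1111 (k : ℕ) where

  m N : ℕ
  m = suc k
  N = 4 + m

  sizes : 2 + (m + 2) ≡ N
  sizes = cong (2 +_) (+-comm m 2)

  module Pos = ThreeBlock 2 m 2 sizes
  open Layout 2 m sizes Pos.splitting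

  Matches : Vec (Fin N) N → Fin N → Set
  Matches σ i = AboveRight σ i × AboveLeft σ i × BelowLeft σ i × BelowRight σ i

  matchesMMP⇒ : ∀ σ i → MatchesMMP 1 1 1 1 σ i → Matches σ i
  matchesMMP⇒ σ i (ar , al , bl , br) =
    aboveRight⁺ σ i ar , aboveLeft⁺ σ i al , belowLeft⁺ σ i bl , belowRight⁺ σ i br

  ⇒matchesMMP : ∀ σ i → Matches σ i → MatchesMMP 1 1 1 1 σ i
  ⇒matchesMMP σ i (ar , al , bl , br) =
    aboveRight⁻ σ i ar , aboveLeft⁻ σ i al , belowLeft⁻ σ i bl , belowRight⁻ σ i br

  outer-unmatched : ∀ σ k → ¬ MatchesMMP 1 1 1 1 σ (Pos.outer k)
  outer-unmatched σ 0F match with matchesMMP⇒ σ _ match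
  ... | _ , _ , bl , _ = first⇒¬BelowLeft σ _ (Pos.toℕ-outer-lower 0F (s≤s z≤n)) bl
  outer-unmatched σ 1F match with matchesMMP⇒ σ _ match
  ... | _ , al , bl , _ =
    second⇒¬AboveLeft×BelowLeft σ _ (Pos.toℕ-outer-lower 1F (s≤s (s≤s z≤n))) (al , bl)
  outer-unmatched σ 2F match with matchesMMP⇒ σ _ match
  ... | ar , _ , _ , br = penultimate⇒¬AboveRight×BelowRight σ _
          (cong (suc ∘ suc) (trans (Pos.toℕ-outer-upper 2F λ { (s≤s (s≤s ())) }) (+-comm m 2))) (ar , br)
  outer-unmatched σ 3F match with matchesMMP⇒ σ _ match
  ... | ar , _ , _ , _ =
    last⇒¬AboveRight σ _ (cong suc (trans (Pos.toℕ-outer-upper 3F λ { (s≤s (s≤s ())) }) (+-comm m 3))) ar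

  open InnerCount 1 1 1 1 2 m 2 sizes outer-unmatched

  MaxPattern : Vec (Fin 4) 4 → Set
  MaxPattern π = Mixed (lookup π 0F) (lookup π 1F) × Mixed (lookup π 2F) (lookup π 3F)

  maxPattern? : (π : Vec (Fin 4) 4) → Dec (MaxPattern π)
  maxPattern? π = mixed? (lookup π 0F) (lookup π 1F) ×-dec mixed? (lookup π 2F) (lookup π 3F)

  inner-values : ∀ σ → IsInjective σ → (∀ j → Matches σ (Pos.inner j)) → PreservesInner σ
  inner-values σ inj all j with all j
  ... | (q , i<q , σi<σq) , (q′ , q′<i , σi<σq′) , (p , p<i , σp<σi) , (p′ , i<p′ , σp′<σi) =
    inner-value (lookup σ (Pos.inner j))
      (two-below⇒2≤ (distinct-values {σ = σ} inj p (Pos.inner j) p′ p<i i<p′) σp<σi σp′<σi)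
      (≤-pred (≤-pred
        (two-above⇒3+≤ (distinct-values {σ = σ} inj q′ (Pos.inner j) q q′<i i<q) σi<σq′ σi<σq)))

  module _ (σ : Vec (Fin N) N) (inj : IsInjective σ) (preserves : PreservesInner σ) where

    open Compare σ inj preserves

    π : Vec (Fin 4) 4
    π = outerPattern σ

    left-outer : ∀ {k} → Pos.Lower k → k ≡ 0F ⊎ k ≡ 1F
    left-outer {0F} _ = inj₁ refl
    left-outer {1F} _ = inj₂ refl
    left-outer {2F} (s≤s (s≤s ()))
    left-outer {3F} (s≤s (s≤s ()))

    right-outer : ∀ {k} → ¬ Pos.Lower k → k ≡ 2F ⊎ k ≡ 3F
    right-outer {0F} upper = ⊥-elim (upper (s≤s z≤n))
    right-outer {1F} upper = ⊥-elim (upper (s≤s (s≤s z≤n)))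
    right-outer {2F} _ = inj₁ refl
    right-outer {3F} _ = inj₂ refl

    first-inner : ∀ {p : Fin N} → p Fin.< Pos.inner 0F → toℕ p < 2
    first-inner {p} = subst (toℕ p <_) (Pos.toℕ-inner 0F)

    last-inner : ∀ {q : Fin N} → Pos.inner (Fin.fromℕ k) Fin.< q → 2 + m ≤ toℕ q
    last-inner {q} =
      subst (λ t → suc t ≤ toℕ q) (trans (Pos.toℕ-inner (Fin.fromℕ k)) (cong (2 +_) (FinP.toℕ-fromℕ k)))

    maxPattern : (∀ j → Matches σ (Pos.inner j)) → MaxPattern π
    maxPattern all = first-mixed , last-mixed
      where
      first-mixed : Mixed (lookup π 0F) (lookup π 1F)
      first-mixed with all 0F
      ... | _ , (q , q<i , σi<σq) , (p , p<i , σp<σi) , _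
        with Pos.below-inner⇒lower q (first-inner {q} q<i) | Pos.below-inner⇒lower p (first-inner {p} p<i)
      ... | k₁ , lower₁ , refl | k₂ , lower₂ , refl =
        mixed-intro 0F 1F π (left-outer lower₁) (left-outer lower₂)
          (above⇒high k₁ 0F σi<σq) (below⇒low k₂ 0F σp<σi)
      last-mixed : Mixed (lookup π 2F) (lookup π 3F)
      last-mixed with all (Fin.fromℕ k)
      ... | (q , i<q , σi<σq) , _ , _ , (p , i<p , σp<σi)
        with Pos.above-inner⇒upper q (last-inner {q} i<q) | Pos.above-inner⇒upper p (last-inner {p} i<p)
      ... | k₁ , upper₁ , refl | k₂ , upper₂ , refl =
        mixed-intro 2F 3F π (right-outer upper₁) (right-outer upper₂)
          (above⇒high k₁ (Fin.fromℕ k) σi<σq) (below⇒low k₂ (Fin.fromℕ k) σp<σi)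

    allMatch : MaxPattern π → ∀ j → Matches σ (Pos.inner j)
    allMatch (first-mixed , last-mixed) j =
      proj₁ (right-witnesses last-mixed) , proj₁ (left-witnesses first-mixed) ,
      proj₂ (left-witnesses first-mixed) , proj₂ (right-witnesses last-mixed)
      where
      left-witnesses : Mixed (lookup π 0F) (lookup π 1F) →
                       AboveLeft σ (Pos.inner j) × BelowLeft σ (Pos.inner j)
      left-witnesses (inj₁ (low , high)) =
        (Pos.outer 1F , Pos.lower<inner 1F j (s≤s (s≤s z≤n)) , high⇒above 1F j high) ,
        (Pos.outer 0F , Pos.lower<inner 0F j (s≤s z≤n) , low⇒below 0F j low)
      left-witnesses (inj₂ (high , low)) =
        (Pos.outer 0F , Pos.lower<inner 0F j (s≤s z≤n) , high⇒above 0F j high) ,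
        (Pos.outer 1F , Pos.lower<inner 1F j (s≤s (s≤s z≤n)) , low⇒below 1F j low)
      right-witnesses : Mixed (lookup π 2F) (lookup π 3F) →
                        AboveRight σ (Pos.inner j) × BelowRight σ (Pos.inner j)
      right-witnesses (inj₁ (low , high)) =
        (Pos.outer 3F , Pos.inner<upper 3F j (λ { (s≤s (s≤s ())) }) , high⇒above 3F j high) ,
        (Pos.outer 2F , Pos.inner<upper 2F j (λ { (s≤s (s≤s ())) }) , low⇒below 2F j low)
      right-witnesses (inj₂ (high , low)) =
        (Pos.outer 2F , Pos.inner<upper 2F j (λ { (s≤s (s≤s ())) }) , high⇒above 2F j high) ,
        (Pos.outer 3F , Pos.inner<upper 3F j (λ { (s≤s (s≤s ())) }) , low⇒below 3F j low)

  maximal⇒ : ∀ σ → IsInjective σ → mmp 1 1 1 1 σ ≡ m → PreservesInner σ × MaxPattern (outerPattern σ)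
  maximal⇒ σ inj e = preserves , maxPattern σ inj preserves all
    where
    all : ∀ j → Matches σ (Pos.inner j)
    all j = matchesMMP⇒ σ _ (mmp≡⇒ σ e j)
    preserves : PreservesInner σ
    preserves = inner-values σ inj all

  maximal⇐ : ∀ σ → IsInjective σ → PreservesInner σ → MaxPattern (outerPattern σ) → mmp 1 1 1 1 σ ≡ m
  maximal⇐ σ inj preserves max = mmp≡⇐ σ (λ j → ⇒matchesMMP σ _ (allMatch σ inj preserves max j))

  max-patterns : sumL (allWords 4 4) (λ π → ⟦ injective? π ×-dec maxPattern? π ⟧) ≡ 16
  max-patterns = refl

  count : Rcoeff 1 1 1 1 N m ≡ 16 * m !
  count = trans (count-maximal 1 1 1 1 maxPattern? maximal⇒ maximal⇐) (cong (_* m !) max-patterns)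

  degree : HasDegreeLeading 1 1 1 1 N m (16 * m !)
  degree = hasDegreeLeading 1 1 1 1 N mmp≤ count (≢-nonZero⁻¹ (16 * m !) {{m*n≢0 16 (m !) {{_}} {{m !≢0}}}})

mainTheorem20 : ((n : ℕ) → 4 ≤ n → HasDegreeLeading 1 0 1 1 n (n ∸ 3) (4 * (n ∸ 3) !))
              × ((n : ℕ) → 5 ≤ n → HasDegreeLeading 1 1 1 1 n (n ∸ 4) (16 * (n ∸ 4) !))
mainTheorem20 = part-i , part-ii
  where
  part-i : (n : ℕ) → 4 ≤ n → HasDegreeLeading 1 0 1 1 n (n ∸ 3) (4 * (n ∸ 3) !)
  part-i _ (s≤s (s≤s (s≤s (s≤s {n = k} _)))) = MaximalMMP1011.degree k

  part-ii : (n : ℕ) → 5 ≤ n → HasDegreeLeading 1 1 1 1 n (n ∸ 4) (16 * (n ∸ 4) !)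
  part-ii _ (s≤s (s≤s (s≤s (s≤s (s≤s {n = k} _))))) = MaximalMMP1111.degree k
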